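{- In LP$^{\mathrm{MLN}}$ (i.e. with respect to semi-strong equivalence $\equiv_{s,s}$), the S-AD transformation is both SE-preserving and NSE-preserving.
   Context: Atoms are propositional. A rule $r$ is an expression $h_1\vee\cdots\vee h_k\leftarrow b_1,\dots,b_m,\mathit{not}\,c_1,\dots,\mathit{not}\,c_n$; write $H(r)$, $B^+(r)$, $B^-(r)$ for the sets of head, positive body and negative body atoms. A program is a finite set of rules. An interpretation $X$ satisfies $r$ iff $X\cap H(r)\neq\emptyset$ or $B^+(r)\not\subseteq X$ or $B^-(r)\cap X\neq\emptyset$. GL-reduct $P^X=\{H(r)\leftarrow B^+(r) : r\in P,\ B^-(r)\cap X=\emptyset\}$; $X$ is an ASP stable model of $P$ iff $X\models P^X$ and no proper subset of $X$ satisfies $P^X$. Weights of LP$^{\mathrm{MLN}}$ rules are omitted; $X$ is an LP$^{\mathrm{MLN}}$ stable model of $P$ iff $X$ is an ASP stable model of $\{r\in P: X\models r\}$. $P\equiv_{s,s}Q$ iff for every program $R$, $P\cup R$ and $Q\cup R$ have the same LP$^{\mathrm{MLN}}$ stable models. Programs are regarded as tuples of rules; $\langle P,Q\rangle$ is the concatenation. For a tuple $T=\langle r_1,\dots,r_n\rangle$ with atom set $at(T)$, let $\langle S_1,\dots,S_{3n}\rangle=\langle H(r_1),B^+(r_1),B^-(r_1),\dots,H(r_n),B^+(r_n),B^-(r_n)\rangle$; for nonempty $N'\subseteq\{1,\dots,3n\}$ the independent set is $I_{N'}=\bigcap_{i\in N'}S_i\setminus\bigcup_{j\notin N'}S_j$.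 The S-AD transformation takes an independent set $I_{N'}$ with $|I_{N'}|\ge 2$ and a fresh atom $a'\notin at(T)$ and adds $a'$ to each $S_i$ with $i\in N'$. For a pair $T=\langle P,Q\rangle$ the result is $\langle P^+,Q^+\rangle$ with $P^+$ the first $|P|$ rules. A transformation type is SE-preserving if for every pair $\langle P,Q\rangle$ and every admissible application $P\equiv_{s,s}Q$ implies $P^+\equiv_{s,s}Q^+$, and NSE-preserving if $P\not\equiv_{s,s}Q$ implies $P^+\not\equiv_{s,s}Q^+$. -}

module Defs where

open import Data.Nat using (ℕ)
open import Data.Bool using (Bool; true; false; if_then_else_)
open import Data.List using (List; []; _∷_; _++_; length; lookup; tabulate; take; drop)
open import Data.List.Membership.Propositional using (_∈_; _∉_)
open import Data.Fin using (Fin)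
open import Data.Product using (Σ; ∃; ∃-syntax; _×_; _,_)
open import Data.Sum using (_⊎_)
open import Relation.Nullary using (¬_)
open import Relation.Binary.PropositionalEquality using (_≡_; _≢_)
open import Function.Bundles using (_⇔_)

Atom : Set
Atom = ℕ

-- Finite sets of atoms are represented by lists (only membership matters).
AtomSet : Set
AtomSet = List Atom

-- A rule  h1 ∨ … ∨ hk ← b1,…,bm, not c1,…,not cn.
record Rule : Set where
  constructor mkRule
  field
    head : AtomSet
    pos  : AtomSet
    neg  : AtomSet
open Rule public

Program : Set
Program = List Rule

RuleSet : Set₁
RuleSet = Rule → Set

ruleSetOf : Program → RuleSet
ruleSetOf P r = r ∈ P

_⊆_ : AtomSet → AtomSet → Set
A ⊆ B = ∀ a → a ∈ A → a ∈ B

_⊂_ : AtomSet → AtomSet → Set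
A ⊂ B = A ⊆ B × ¬ (B ⊆ A)

Meets : AtomSet → AtomSet → Set
Meets A B = ∃[ a ] (a ∈ A × a ∈ B)

_⊨_ : AtomSet → Rule → Set
X ⊨ r = Meets X (head r) ⊎ (¬ (pos r ⊆ X) ⊎ Meets (neg r) X)

_⊨ₚ_ : AtomSet → RuleSet → Set
X ⊨ₚ Π = ∀ r → Π r → X ⊨ r

reduct : RuleSet → AtomSet → RuleSet
reduct Π X r' = ∃[ r ] (Π r × ¬ Meets (neg r) X × r' ≡ mkRule (head r) (pos r) [])

ASPStable : RuleSet → AtomSet → Set
ASPStable Π X = (X ⊨ₚ reduct Π X) × (∀ Y → Y ⊂ X → ¬ (Y ⊨ₚ reduct Π X))

LPMLNStable : Program → AtomSet → Set
LPMLNStable P X = ASPStable (λ r → r ∈ P × X ⊨ r) X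

_≡ₛₛ_ : Program → Program → Set
P ≡ₛₛ Q = ∀ (R : Program) (X : AtomSet) → LPMLNStable (P ++ R) X ⇔ LPMLNStable (Q ++ R) X

-- The sequence ⟨S₁,…,S₃ₙ⟩ = ⟨H(r₁),B⁺(r₁),B⁻(r₁),…⟩ is indexed by positions
-- (i , c) with i : Fin n the rule index and c the component; position
-- (i , c) corresponds to index 3i + c + 1.

data Comp : Set where
  H B⁺ B⁻ : Comp

comp : Comp → Rule → AtomSet
comp H  r = head r
comp B⁺ r = pos r
comp B⁻ r = neg r

S : (T : Program) → Fin (length T) → Comp → AtomSet
S T i c = comp c (lookup T i)

-- A subset N' of the index set {1,…,3n}
Selection : Program → Set
Selection T = Fin (length T) → Comp → Bool

NonemptySel : (T : Program) → Selection T → Set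
NonemptySel T N = ∃[ i ] ∃[ c ] (N i c ≡ true)

_∈I[_,_] : Atom → (T : Program) → Selection T → Set
a ∈I[ T , N ] = (∀ i c → N i c ≡ true → a ∈ S T i c)
              × (∀ i c → N i c ≡ false → a ∉ S T i c)

AtLeastTwo : (T : Program) → Selection T → Set
AtLeastTwo T N = ∃[ a ] ∃[ b ] (a ≢ b × a ∈I[ T , N ] × b ∈I[ T , N ])

_∈at_ : Atom → Program → Set
a ∈at T = ∃[ r ] (r ∈ T × ∃[ c ] (a ∈ comp c r))

addIf : Bool → Atom → AtomSet → AtomSet
addIf b a' A = if b then a' ∷ A else A

sad : (T : Program) → Selection T → Atom → Program
sad T N a' = tabulate λ i →
  mkRule (addIf (N i H) a' (S T i H))
         (addIf (N i B⁺) a' (S T i B⁺))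
         (addIf (N i B⁻) a' (S T i B⁻))

Admissible : (T : Program) → Selection T → Atom → Set
Admissible T N a' = NonemptySel T N × AtLeastTwo T N × ¬ (a' ∈at T)

sadFst sadSnd : (P Q : Program) → Selection (P ++ Q) → Atom → Program
sadFst P Q N a' = take (length P) (sad (P ++ Q) N a')
sadSnd P Q N a' = drop (length P) (sad (P ++ Q) N a')

SE-preserving-SAD : Set
SE-preserving-SAD = ∀ (P Q : Program) (N : Selection (P ++ Q)) (a' : Atom) →
  Admissible (P ++ Q) N a' → P ≡ₛₛ Q → sadFst P Q N a' ≡ₛₛ sadSnd P Q N a'

NSE-preserving-SAD : Set
NSE-preserving-SAD = ∀ (P Q : Program) (N : Selection (P ++ Q)) (a' : Atom) →
  Admissible (P ++ Q) N a' → ¬ (P ≡ₛₛ Q) → ¬ (sadFst P Q N a' ≡ₛₛ sadSnd P Q N a')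

-- P ≡ₛₛ Q holds iff, for all Y ⊂ X, Y satisfies the GL-reduct (w.r.t. X) of the
-- rules of P that X satisfies exactly when it does so for Q; for the converse, a
-- separating context built from X and Y makes X stable for Q ∪ R but not P ∪ R.
-- The atoms of an independent set I occur in exactly the same rule components,
-- and S-AD adds a' to precisely those components, so a' behaves like one more
-- member of I.  Hence X and X' correspond when I occurs in X to the same extent
-- (not at all, partially, totally) as I ∪ {a'} does in X', and X, X' agree
-- elsewhere; corresponding interpretations give every rule and its transform
-- the same satisfaction and reduct behaviour.  Since |I| ≥ 2 the partial extent
-- is realisable on the original side, so ordered pairs Y ⊆ X can be moved
-- across the transformation in both directions, and the characterisation
-- transfers.
module Submission where

open import Defs
open import Data.Bool using (true; false)
open import Data.Empty using (⊥; ⊥-elim)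
open import Data.List using ([]; _∷_; _++_; length; lookup; take; drop; map; filter)
open import Data.List.Membership.Propositional using (_∈_; _∉_)
open import Data.List.Membership.Propositional.Properties
  using (∈-++⁺ˡ; ∈-++⁺ʳ; ∈-++⁻; ∈-map⁺; ∈-map⁻; ∈-filter⁺; ∈-filter⁻; ∈-lookup)
open import Data.List.Properties using (tabulate-lookup)
open import Data.List.Relation.Binary.Pointwise using (Pointwise; []; _∷_; tabulate⁺)
open import Data.List.Relation.Binary.Pointwise.Properties using (symmetric)
open import Data.List.Relation.Unary.Any using (here; there)
open import Data.Nat using (_≟_)
open import Data.List.Membership.DecPropositional _≟_ using (_∈?_)
open import Data.Product using (_×_; ∃-syntax; _,_; proj₁; proj₂; uncurry)
open import Data.Product.Function.NonDependent.Propositional using (_×-⇔_)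
open import Data.Sum using (_⊎_; inj₁; inj₂; [_,_])
open import Data.Sum.Function.Propositional using (_⊎-⇔_)
open import Effect.Monad using (RawMonad)
open import Function using (_∘_; flip)
open import Function.Bundles using (_⇔_; mk⇔; Equivalence)
open import Function.Construct.Composition using (_⇔-∘_)
open import Function.Construct.Identity using (⇔-id)
open import Function.Construct.Symmetry using (⇔-sym)
open import Function.Related.TypeIsomorphisms using (¬-cong-⇔)
open import Level using (0ℓ)
open import Relation.Binary.PropositionalEquality using (_≡_; _≢_; refl; sym; subst)
open import Relation.Nullary using (¬_; yes; no; ¬?)
open import Relation.Nullary.Decidable using (decidable-stable; ¬¬-excluded-middle)
open import Relation.Nullary.Negation using (¬¬-Monad)

open Equivalence using (to; from)
open RawMonad (¬¬-Monad {a = 0ℓ}) using (_>>=_; return)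

private
  variable
    A : AtomSet
    X X' Y Y' Z Z' : AtomSet
    P P' Q Q' R : Program
    r r' : Rule
    x : Atom
    J : Atom → Set

∈-stable : ¬ ¬ x ∈ Z → x ∈ Z
∈-stable = decidable-stable (_ ∈? _)

meets-comm : Meets A Z ⇔ Meets Z A
meets-comm = mk⇔ (λ (x , p , q) → x , q , p) (λ (x , p , q) → x , q , p)

remove : Atom → AtomSet → AtomSet
remove y = filter (λ x → ¬? (x ≟ y))

∈-remove⁻ : ∀ {y} Z → x ∈ remove y Z → x ∈ Z × x ≢ y
∈-remove⁻ {y = y} Z = ∈-filter⁻ (λ x → ¬? (x ≟ y)) {xs = Z}

∈-remove⁺ : ∀ {y} → x ∈ Z → x ≢ y → x ∈ remove y Z
∈-remove⁺ {y = y} = ∈-filter⁺ (λ x → ¬? (x ≟ y))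

remove-mono : ∀ {y} → Y ⊆ X → remove y Y ⊆ remove y X
remove-mono {Y = Y} Y⊆X x q = let (xY , x≢y) = ∈-remove⁻ Y q in ∈-remove⁺ (Y⊆X x xY) x≢y

positivePart : Rule → Rule
positivePart r = mkRule (head r) (pos r) []

ReductSat : Program → AtomSet → AtomSet → Set
ReductSat P X Y = ∀ r → r ∈ P → X ⊨ r → ¬ Meets (neg r) X → Y ⊨ positivePart r

reductSat⇔ : Y ⊨ₚ reduct (λ r → r ∈ P × X ⊨ r) X ⇔ ReductSat P X Y
reductSat⇔ = mk⇔ (λ sat r r∈P X⊨r ¬m → sat _ (r , (r∈P , X⊨r) , ¬m , refl))
                 (λ { sat _ (r , (r∈P , X⊨r) , ¬m , refl) → sat r r∈P X⊨r ¬m })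

reductSat-++ : ReductSat (P ++ R) X Y ⇔ (ReductSat P X Y × ReductSat R X Y)
reductSat-++ {P = P} = mk⇔
  (λ sat → (λ r → sat r ∘ ∈-++⁺ˡ) , (λ r → sat r ∘ ∈-++⁺ʳ P))
  (λ (satP , satR) r m → [ satP r , satR r ] (∈-++⁻ P m))

reductSat-refl : ReductSat P X X
reductSat-refl _ _ (inj₁ m)         _  = inj₁ m
reductSat-refl _ _ (inj₂ (inj₁ ¬s)) _  = inj₂ (inj₁ ¬s)
reductSat-refl _ _ (inj₂ (inj₂ m))  ¬m = ⊥-elim (¬m m)

reductSat-resp : Y ⊆ Z → Z ⊆ Y → ReductSat P X Z → ReductSat P X Y
reductSat-resp Y⊆Z Z⊆Y sat r r∈P X⊨r ¬m with sat r r∈P X⊨r ¬m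
... | inj₁ (x , xZ , xh)       = inj₁ (x , Z⊆Y x xZ , xh)
... | inj₂ (inj₁ ¬s)           = inj₂ (inj₁ (λ s → ¬s (λ x xp → Y⊆Z x (s x xp))))
... | inj₂ (inj₂ (_ , () , _))

reductSat-fires : ∀ {h B} → ReductSat P X Z → mkRule (h ∷ []) B [] ∈ P → h ∈ X → B ⊆ Z → h ∈ Z
reductSat-fires sat r∈P hX B⊆Z with sat _ r∈P (inj₁ (_ , hX , here refl)) (λ { (_ , () , _) })
... | inj₁ (_ , hZ , here refl) = hZ
... | inj₂ (inj₁ ¬s)            = ⊥-elim (¬s B⊆Z)
... | inj₂ (inj₂ (_ , () , _))

lpmlnStable⇔ : LPMLNStable P X ⇔ (∀ Y → Y ⊂ X → ¬ ReductSat P X Y)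
lpmlnStable⇔ = mk⇔
  (λ (_ , minimal) Y Y⊂X → minimal Y Y⊂X ∘ from reductSat⇔)
  (λ minimal → from reductSat⇔ reductSat-refl , λ Y Y⊂X → minimal Y Y⊂X ∘ to reductSat⇔)

ReductEntails : Program → Program → Set
ReductEntails P Q = ∀ X Y → Y ⊂ X → ReductSat P X Y → ¬ ¬ ReductSat Q X Y

reductEntails⇒≡ₛₛ : ReductEntails P Q → ReductEntails Q P → P ≡ₛₛ Q
reductEntails⇒≡ₛₛ P⇒Q Q⇒P R X = mk⇔ (preserve Q⇒P) (preserve P⇒Q)
  where
  preserve : ReductEntails Q P → LPMLNStable (P ++ R) X → LPMLNStable (Q ++ R) X
  preserve Q⇒P stable = from lpmlnStable⇔ λ Y Y⊂X satQR →
    let (satQ , satR) = to reductSat-++ satQR in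
    Q⇒P X Y Y⊂X satQ λ satP → to lpmlnStable⇔ stable Y Y⊂X (from reductSat-++ (satP , satR))

module Separator (X Y : AtomSet) (d : Atom) where

  fact : Atom → Rule
  fact y = mkRule (y ∷ []) [] []

  _⟵_ : Atom → Atom → Rule
  h ⟵ b = mkRule (h ∷ []) (b ∷ []) []

  outside : AtomSet
  outside = filter (λ x → ¬? (x ∈? Y)) X

  -- Y is forced, d generates all of X, and every atom of X ∖ Y generates d.
  separator : Program
  separator = map fact Y ++ map (_⟵ d) X ++ map (d ⟵_) outside

  separator-sat : d ∉ Y → ReductSat separator X Y
  separator-sat d∉Y r r∈R _ _ with ∈-++⁻ (map fact Y) r∈R
  ... | inj₁ m with ∈-map⁻ fact m
  ...   | y , yY , refl = inj₁ (y , yY , here refl)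
  separator-sat d∉Y r r∈R _ _ | inj₂ m with ∈-++⁻ (map (_⟵ d) X) m
  ... | inj₁ m' with ∈-map⁻ (_⟵ d) m'
  ...   | _ , _ , refl = inj₂ (inj₁ (λ s → d∉Y (s d (here refl))))
  separator-sat d∉Y r r∈R _ _ | inj₂ m | inj₂ m' with ∈-map⁻ (d ⟵_) m'
  ... | e , e∈out , refl =
    inj₂ (inj₁ (λ s → proj₂ (∈-filter⁻ (λ x → ¬? (x ∈? Y)) {xs = X} e∈out) (s e (here refl))))

  separator-squeeze : d ∈ X → Y ⊆ X → Z ⊂ X → ReductSat separator X Z → Z ⊆ Y × Y ⊆ Z
  separator-squeeze {Z} dX Y⊆X (Z⊆X , X⊈Z) sat = Z⊆Y , Y⊆Z
    where
    Y⊆Z : Y ⊆ Z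
    Y⊆Z y yY = reductSat-fires sat (∈-++⁺ˡ (∈-map⁺ fact yY)) (Y⊆X y yY) (λ _ ())
    d∉Z : d ∉ Z
    d∉Z dZ = X⊈Z λ x xX →
      reductSat-fires sat (∈-++⁺ʳ (map fact Y) (∈-++⁺ˡ (∈-map⁺ (_⟵ d) xX))) xX
                      (λ { _ (here refl) → dZ })
    Z⊆Y : Z ⊆ Y
    Z⊆Y z zZ with z ∈? Y
    ... | yes zY = zY
    ... | no z∉Y = ⊥-elim (d∉Z (reductSat-fires sat
          (∈-++⁺ʳ (map fact Y) (∈-++⁺ʳ (map (_⟵ d) X)
            (∈-map⁺ (d ⟵_) (∈-filter⁺ (λ x → ¬? (x ∈? Y)) (Z⊆X z zZ) z∉Y))))
          dX (λ { _ (here refl) → zZ })))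

≡ₛₛ⇒reductEntails : P ≡ₛₛ Q → ReductEntails P Q
≡ₛₛ⇒reductEntails {P} {Q} P≡Q X Y Y⊂X@(Y⊆X , X⊈Y) satP ¬satQ =
  X⊈Y λ d dX → ∈-stable λ d∉Y → separated d dX d∉Y
  where
  separated : ∀ d → d ∈ X → d ∉ Y → ⊥
  separated d dX d∉Y = to lpmlnStable⇔ (from (P≡Q separator X) stableQR) Y Y⊂X
                         (from reductSat-++ (satP , separator-sat d∉Y))
    where
    open Separator X Y d
    stableQR : LPMLNStable (Q ++ separator) X
    stableQR = from lpmlnStable⇔ λ Z Z⊂X satQR →
      let (satQ , satR) = to reductSat-++ satQR
          (Z⊆Y , Y⊆Z)   = separator-squeeze dX Y⊆X Z⊂X satR
      in ¬satQ (reductSat-resp Y⊆Z Z⊆Y satQ)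

≡ₛₛ-sym : P ≡ₛₛ Q → Q ≡ₛₛ P
≡ₛₛ-sym P≡Q R X = ⇔-sym (P≡Q R X)

≡ₛₛ⇔reductEntails : P ≡ₛₛ Q ⇔ (ReductEntails P Q × ReductEntails Q P)
≡ₛₛ⇔reductEntails = mk⇔
  (λ P≡Q → ≡ₛₛ⇒reductEntails P≡Q , ≡ₛₛ⇒reductEntails (≡ₛₛ-sym P≡Q))
  (λ (P⇒Q , Q⇒P) → reductEntails⇒≡ₛₛ P⇒Q Q⇒P)

ReductInvariant : (AtomSet → AtomSet → Set) → Program → Program → Set
ReductInvariant C P P' = ∀ {X X' Y Y'} → C X X' → C Y Y' → ReductSat P X Y ⇔ ReductSat P' X' Y'

PairSurjective : (AtomSet → AtomSet → Set) → Set
PairSurjective C = ∀ X' Y' → Y' ⊆ X' → ¬ ¬ (∃[ X ] ∃[ Y ] (Y ⊆ X × C X X' × C Y Y'))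

reductInvariant-flip : ∀ {C} → ReductInvariant C P P' → ReductInvariant (flip C) P' P
reductInvariant-flip inv cX cY = ⇔-sym (inv cX cY)

reductEntails-transfer : ∀ {C} → ReductInvariant C P P' → ReductInvariant C Q Q' →
                         PairSurjective C → ReductEntails P Q → ReductEntails P' Q'
reductEntails-transfer invP invQ surj P⇒Q X' Y' (Y'⊆X' , _) satP' ¬satQ' =
  surj X' Y' Y'⊆X' λ (X , Y , Y⊆X , cX , cY) → ¬¬-excluded-middle λ where
    (yes X⊆Y) → ¬satQ' (to (invQ cX cY) (reductSat-resp Y⊆X X⊆Y reductSat-refl))
    (no X⊈Y)  → P⇒Q X Y (Y⊆X , X⊈Y) (from (invP cX cY) satP') (¬satQ' ∘ to (invQ cX cY))

Corresponds : AtomSet → AtomSet → AtomSet → AtomSet → Set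
Corresponds Z Z' A A' = (Meets A Z ⇔ Meets A' Z') × (A ⊆ Z ⇔ A' ⊆ Z')

RuleCorr : AtomSet → AtomSet → Rule → Rule → Set
RuleCorr Z Z' r r' = ∀ c → Corresponds Z Z' (comp c r) (comp c r')

ruleCorr-sym : RuleCorr Z Z' r r' → RuleCorr Z' Z r' r
ruleCorr-sym rc c = ⇔-sym (proj₁ (rc c)) , ⇔-sym (proj₂ (rc c))

positivePart-corr : RuleCorr Z Z' r r' → RuleCorr Z Z' (positivePart r) (positivePart r')
positivePart-corr rc H  = rc H
positivePart-corr rc B⁺ = rc B⁺
positivePart-corr rc B⁻ = mk⇔ (λ { (_ , () , _) }) (λ { (_ , () , _) }) , mk⇔ (λ _ _ ()) (λ _ _ ())

⊨-cong : RuleCorr Z Z' r r' → Z ⊨ r ⇔ Z' ⊨ r'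
⊨-cong rc = (meets-comm ⇔-∘ (proj₁ (rc H) ⇔-∘ meets-comm))
          ⊎-⇔ (¬-cong-⇔ (proj₂ (rc B⁺)) ⊎-⇔ proj₁ (rc B⁻))

reductSat-transport : Pointwise (RuleCorr X X') P P' → Pointwise (RuleCorr Y Y') P P' →
                      ReductSat P X Y → ReductSat P' X' Y'
reductSat-transport (cx ∷ _) (cy ∷ _) sat _ (here refl) X'⊨r' ¬m' =
  to (⊨-cong (positivePart-corr cy))
     (sat _ (here refl) (from (⊨-cong cx) X'⊨r') (¬m' ∘ to (proj₁ (cx B⁻))))
reductSat-transport (_ ∷ px) (_ ∷ py) sat r' (there m) =
  reductSat-transport px py (λ r → sat r ∘ there) r' m

reductSat-cong : Pointwise (RuleCorr X X') P P' → Pointwise (RuleCorr Y Y') P P' →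
                 ReductSat P X Y ⇔ ReductSat P' X' Y'
reductSat-cong px py = mk⇔ (reductSat-transport px py)
  (reductSat-transport (symmetric ruleCorr-sym px) (symmetric ruleCorr-sym py))

pointwise-++⁻ : ∀ {Rel : Rule → Rule → Set} P {Q T} → Pointwise Rel (P ++ Q) T →
                Pointwise Rel P (take (length P) T) × Pointwise Rel Q (drop (length P) T)
pointwise-++⁻ []      pw        = [] , pw
pointwise-++⁻ (_ ∷ P) (rel ∷ pw) = let (pwP , pwQ) = pointwise-++⁻ P pw in rel ∷ pwP , pwQ

Hits Covers : (Atom → Set) → AtomSet → Set
Hits J Z = ∃[ x ] (J x × x ∈ Z)
Covers J Z = ∀ x → J x → x ∈ Z

data Extent : Set where
  none partial total : Extent

Occurs : Extent → (Atom → Set) → AtomSet → Set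
Occurs none    J Z = ¬ Hits J Z
Occurs partial J Z = Hits J Z × ¬ Covers J Z
Occurs total   J Z = Covers J Z

extent : ∀ J Z → ¬ ¬ (∃[ e ] Occurs e J Z)
extent J Z = ¬¬-excluded-middle >>= λ where
  (no ¬hit) → return (none , ¬hit)
  (yes hit) → ¬¬-excluded-middle >>= λ where
    (yes cov) → return (total , cov)
    (no ¬cov) → return (partial , hit , ¬cov)

hits-mono : Y ⊆ X → Hits J Y → Hits J X
hits-mono Y⊆X (x , jx , xY) = x , jx , Y⊆X x xY

covers-mono : Y ⊆ X → Covers J Y → Covers J X
covers-mono Y⊆X cov x jx = Y⊆X x (cov x jx)

Agree : (Atom → Set) → AtomSet → AtomSet → Set
Agree J Z Z' = ∀ x → ¬ J x → x ∈ Z ⇔ x ∈ Z'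

agree-sym : Agree J Z Z' → Agree J Z' Z
agree-sym agree x ¬jx = ⇔-sym (agree x ¬jx)

agree-corresponds : Agree J Z Z' → (∀ x → x ∈ A → ¬ J x) → Corresponds Z Z' A A
agree-corresponds agree off =
  mk⇔ (λ (x , xA , xZ) → x , xA , to (agree x (off x xA)) xZ)
      (λ (x , xA , xZ') → x , xA , from (agree x (off x xA)) xZ') ,
  mk⇔ (λ A⊆Z x xA → to (agree x (off x xA)) (A⊆Z x xA))
      (λ A⊆Z' x xA → from (agree x (off x xA)) (A⊆Z' x xA))

⊆-via-agree : Agree J Z Z' → (∀ x → x ∈ A → J x → x ∈ Z') → A ⊆ Z → A ⊆ Z'
⊆-via-agree {J = J} agree onJ A⊆Z x xA = ∈-stable λ x∉Z' → ¬¬-excluded-middle {A = J x} λ where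
  (yes jx) → x∉Z' (onJ x xA jx)
  (no ¬jx) → x∉Z' (to (agree x ¬jx) (A⊆Z x xA))

module S-AD (T : Program) (N : Selection T) (a' : Atom) (selected : NonemptySel T N)
            {a b : Atom} (a≢b : a ≢ b) (a∈I : a ∈I[ T , N ]) (b∈I : b ∈I[ T , N ])
            (fresh : ¬ (a' ∈at T)) where

  I I⁺ : Atom → Set
  I x = x ∈I[ T , N ]
  I⁺ x = I x ⊎ x ≡ a'

  a'∉S : ∀ i c → a' ∉ S T i c
  a'∉S i c m = fresh (lookup T i , ∈-lookup i , c , m)

  I-fresh : I x → x ≢ a'
  I-fresh ix refl = let (i , c , Nic) = selected in a'∉S i c (proj₁ ix i c Nic)

  Counterpart : AtomSet → AtomSet → Set
  Counterpart Z Z' = (∃[ e ] (Occurs e I Z × Occurs e I⁺ Z')) × Agree I⁺ Z Z'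

  selected-corresponds : Counterpart Z Z' → Covers I A → a' ∉ A → Corresponds Z Z' A (a' ∷ A)
  selected-corresponds {Z} {Z'} {A} ((e , occ , occ') , agree) I⊆A a'∉A = meets e occ occ' , subset e occ occ'
    where
    off : x ∈ A → ¬ I x → ¬ I⁺ x
    off xA ¬ix = [ ¬ix , (λ { refl → a'∉A xA }) ]
    meets-I : Hits I Z → Meets A Z
    meets-I (x , ix , xZ) = x , I⊆A x ix , xZ
    meets-I⁺ : Hits I⁺ Z' → Meets (a' ∷ A) Z'
    meets-I⁺ (x , inj₁ ix , xZ')   = x , there (I⊆A x ix) , xZ'
    meets-I⁺ (x , inj₂ refl , xZ') = x , here refl , xZ'
    meets : ∀ e → Occurs e I Z → Occurs e I⁺ Z' → Meets A Z ⇔ Meets (a' ∷ A) Z'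
    meets none ¬hit ¬hit' = mk⇔
      (λ (x , xA , xZ) → x , there xA , to (agree x (off xA (λ ix → ¬hit (x , ix , xZ)))) xZ)
      (λ { (x , here refl , xZ') → ⊥-elim (¬hit' (x , inj₂ refl , xZ'))
         ; (x , there xA , xZ')  → x , xA , from (agree x (λ i⁺x → ¬hit' (x , i⁺x , xZ'))) xZ' })
    meets partial (hit , _) (hit' , _) = mk⇔ (λ _ → meets-I⁺ hit') (λ _ → meets-I hit)
    meets total cov cov' =
      mk⇔ (λ _ → meets-I⁺ (a , inj₁ a∈I , cov' a (inj₁ a∈I))) (λ _ → meets-I (a , a∈I , cov a a∈I))
    subset : ∀ e → Occurs e I Z → Occurs e I⁺ Z' → A ⊆ Z ⇔ (a' ∷ A) ⊆ Z'
    subset none ¬hit ¬hit' = mk⇔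
      (λ A⊆Z → ⊥-elim (¬hit (a , a∈I , A⊆Z a (I⊆A a a∈I))))
      (λ A⊆Z' → ⊥-elim (¬hit' (a' , inj₂ refl , A⊆Z' a' (here refl))))
    subset partial (_ , ¬cov) (_ , ¬cov') = mk⇔
      (λ A⊆Z → ⊥-elim (¬cov λ x ix → A⊆Z x (I⊆A x ix)))
      (λ A⊆Z' → ⊥-elim (¬cov' λ { x (inj₁ ix) → A⊆Z' x (there (I⊆A x ix))
                                ; x (inj₂ refl) → A⊆Z' a' (here refl) }))
    subset total cov cov' = mk⇔
      (λ A⊆Z → λ { x (here refl) → cov' a' (inj₂ refl)
                 ; x (there xA)  → ⊆-via-agree agree (λ y _ → cov' y) A⊆Z x xA })
      (λ A⊆Z' → ⊆-via-agree (agree-sym agree)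
                  (λ { y _ (inj₁ iy) → cov y iy ; y yA (inj₂ refl) → ⊥-elim (a'∉A yA) })
                  (λ y yA → A⊆Z' y (there yA)))

  component-corresponds : Counterpart Z Z' → ∀ i c →
                          Corresponds Z Z' (S T i c) (addIf (N i c) a' (S T i c))
  component-corresponds cp i c with N i c in Nic
  ... | true  = selected-corresponds cp (λ x ix → proj₁ ix i c Nic) (a'∉S i c)
  ... | false = agree-corresponds (proj₂ cp)
                  (λ x xS → [ (λ ix → proj₂ ix i c Nic xS) , (λ { refl → a'∉S i c xS }) ])

  sad-corresponds : Counterpart Z Z' → Pointwise (RuleCorr Z Z') T (sad T N a')
  sad-corresponds {Z} {Z'} cp = subst (λ T₀ → Pointwise (RuleCorr Z Z') T₀ (sad T N a')) (tabulate-lookup T)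
    (tabulate⁺ λ i → λ { H → component-corresponds cp i H
                       ; B⁺ → component-corresponds cp i B⁺
                       ; B⁻ → component-corresponds cp i B⁻ })

  -- The partial extent of I ∪ {a'} is realised by keeping a and dropping b.
  toOriginal : Extent → AtomSet → AtomSet
  toOriginal none    Z' = Z'
  toOriginal partial Z' = a ∷ remove b Z'
  toOriginal total   Z' = Z'

  toOriginal-counterpart : ∀ e → Occurs e I⁺ Z' → Counterpart (toOriginal e Z') Z'
  toOriginal-counterpart none ¬hit' =
    (none , (λ (x , ix , xZ') → ¬hit' (x , inj₁ ix , xZ')) , ¬hit') , λ _ _ → ⇔-id _
  toOriginal-counterpart total cov' =
    (total , (λ x ix → cov' x (inj₁ ix)) , cov') , λ _ _ → ⇔-id _
  toOriginal-counterpart {Z'} partial occ' =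
    (partial , ((a , a∈I , here refl) , λ cov → b∉ (cov b b∈I)) , occ') , agree
    where
    b∉ : b ∉ a ∷ remove b Z'
    b∉ (here b≡a) = a≢b (sym b≡a)
    b∉ (there q)  = proj₂ (∈-remove⁻ Z' q) refl
    agree : Agree I⁺ (a ∷ remove b Z') Z'
    agree x ¬i⁺x = mk⇔ (λ { (here refl) → ⊥-elim (¬i⁺x (inj₁ a∈I))
                          ; (there q)   → proj₁ (∈-remove⁻ Z' q) })
                       (λ xZ' → there (∈-remove⁺ xZ' (λ { refl → ¬i⁺x (inj₁ b∈I) })))

  toOriginal-mono : ∀ e f → Occurs e I⁺ Y' → Occurs f I⁺ X' → Y' ⊆ X' →
                    toOriginal e Y' ⊆ toOriginal f X'
  toOriginal-mono none    none    _ _ s = s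
  toOriginal-mono none    total   _ _ s = s
  toOriginal-mono total   total   _ _ s = s
  toOriginal-mono total   none    cov ¬hit s = ⊥-elim (¬hit (a' , inj₂ refl , s a' (cov a' (inj₂ refl))))
  toOriginal-mono total   partial cov (_ , ¬cov) s = ⊥-elim (¬cov (covers-mono s cov))
  toOriginal-mono partial none    (hit , _) ¬hit s = ⊥-elim (¬hit (hits-mono s hit))
  toOriginal-mono partial total   _ cov s _ (here refl) = cov a (inj₁ a∈I)
  toOriginal-mono {Y'} partial total _ _ s y (there q) = s y (proj₁ (∈-remove⁻ Y' q))
  toOriginal-mono partial partial _ _ s _ (here refl) = here refl
  toOriginal-mono partial partial _ _ s y (there q) = there (remove-mono s y q)
  toOriginal-mono none    partial ¬hit _ s y yY' =
    there (∈-remove⁺ (s y yY') (λ { refl → ¬hit (b , inj₁ b∈I , yY') }))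

  toTransformed : Extent → AtomSet → AtomSet
  toTransformed none    Z = remove a' Z
  toTransformed partial Z = remove a' Z
  toTransformed total   Z = a' ∷ Z

  agree-remove : Agree I⁺ Z (remove a' Z)
  agree-remove {Z} x ¬i⁺x = mk⇔ (λ xZ → ∈-remove⁺ xZ (¬i⁺x ∘ inj₂)) (proj₁ ∘ ∈-remove⁻ Z)

  toTransformed-counterpart : ∀ e → Occurs e I Z → Counterpart Z (toTransformed e Z)
  toTransformed-counterpart {Z} none ¬hit = (none , ¬hit , ¬hit') , agree-remove
    where
    ¬hit' : ¬ Hits I⁺ (remove a' Z)
    ¬hit' (x , inj₁ ix , q)   = ¬hit (x , ix , proj₁ (∈-remove⁻ Z q))
    ¬hit' (x , inj₂ refl , q) = proj₂ (∈-remove⁻ Z q) refl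
  toTransformed-counterpart {Z} partial occ@((x , ix , xZ) , _) =
    (partial , occ , ((x , inj₁ ix , ∈-remove⁺ xZ (I-fresh ix)) ,
                      λ cov' → proj₂ (∈-remove⁻ Z (cov' a' (inj₂ refl))) refl)) , agree-remove
  toTransformed-counterpart {Z} total cov = (total , cov , cov') , agree
    where
    cov' : Covers I⁺ (a' ∷ Z)
    cov' x (inj₁ ix)   = there (cov x ix)
    cov' x (inj₂ refl) = here refl
    agree : Agree I⁺ Z (a' ∷ Z)
    agree x ¬i⁺x = mk⇔ there (λ { (here refl) → ⊥-elim (¬i⁺x (inj₂ refl)) ; (there q) → q })

  toTransformed-mono : ∀ e f → Occurs e I Y → Occurs f I X → Y ⊆ X →
                       toTransformed e Y ⊆ toTransformed f X
  toTransformed-mono none    none    _ _ s = remove-mono s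
  toTransformed-mono none    partial _ _ s = remove-mono s
  toTransformed-mono partial none    _ _ s = remove-mono s
  toTransformed-mono partial partial _ _ s = remove-mono s
  toTransformed-mono {Y} none    total _ _ s y q = there (s y (proj₁ (∈-remove⁻ Y q)))
  toTransformed-mono {Y} partial total _ _ s y q = there (s y (proj₁ (∈-remove⁻ Y q)))
  toTransformed-mono total total _ _ s _ (here refl) = here refl
  toTransformed-mono total total _ _ s y (there q)   = there (s y q)
  toTransformed-mono total none    cov ¬hit s = ⊥-elim (¬hit (a , a∈I , s a (cov a a∈I)))
  toTransformed-mono total partial cov (_ , ¬cov) s = ⊥-elim (¬cov (covers-mono s cov))

  pairs-from-transformed : PairSurjective Counterpart
  pairs-from-transformed X' Y' Y'⊆X' = do
    e , occX ← extent I⁺ X'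
    f , occY ← extent I⁺ Y'
    return (toOriginal e X' , toOriginal f Y' , toOriginal-mono f e occY occX Y'⊆X' ,
            toOriginal-counterpart e occX , toOriginal-counterpart f occY)

  pairs-from-original : PairSurjective (flip Counterpart)
  pairs-from-original X Y Y⊆X = do
    e , occX ← extent I X
    f , occY ← extent I Y
    return (toTransformed e X , toTransformed f Y , toTransformed-mono f e occY occX Y⊆X ,
            toTransformed-counterpart e occX , toTransformed-counterpart f occY)

sad-reductEntails : ∀ P Q N a' → Admissible (P ++ Q) N a' →
  let P⁺ = sadFst P Q N a'; Q⁺ = sadSnd P Q N a' in
  (ReductEntails P Q ⇔ ReductEntails P⁺ Q⁺) × (ReductEntails Q P ⇔ ReductEntails Q⁺ P⁺)
sad-reductEntails P Q N a' (selected , (a , b , a≢b , a∈I , b∈I) , fresh) =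
  mk⇔ (reductEntails-transfer invP invQ pairs-from-transformed)
      (reductEntails-transfer (reductInvariant-flip invP) (reductInvariant-flip invQ) pairs-from-original) ,
  mk⇔ (reductEntails-transfer invQ invP pairs-from-transformed)
      (reductEntails-transfer (reductInvariant-flip invQ) (reductInvariant-flip invP) pairs-from-original)
  where
  open S-AD (P ++ Q) N a' selected a≢b a∈I b∈I fresh
  split : Counterpart Z Z' → Pointwise (RuleCorr Z Z') P (sadFst P Q N a') ×
                              Pointwise (RuleCorr Z Z') Q (sadSnd P Q N a')
  split cp = pointwise-++⁻ P (sad-corresponds cp)
  invP : ReductInvariant Counterpart P (sadFst P Q N a')
  invP cX cY = reductSat-cong (proj₁ (split cX)) (proj₁ (split cY))
  invQ : ReductInvariant Counterpart Q (sadSnd P Q N a')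
  invQ cX cY = reductSat-cong (proj₂ (split cX)) (proj₂ (split cY))

sad-≡ₛₛ : ∀ P Q N a' → Admissible (P ++ Q) N a' → P ≡ₛₛ Q ⇔ sadFst P Q N a' ≡ₛₛ sadSnd P Q N a'
sad-≡ₛₛ P Q N a' adm =
  ⇔-sym ≡ₛₛ⇔reductEntails ⇔-∘ (uncurry _×-⇔_ (sad-reductEntails P Q N a' adm) ⇔-∘ ≡ₛₛ⇔reductEntails)

theorem5 : SE-preserving-SAD × NSE-preserving-SAD
theorem5 = (λ P Q N a' adm → to (sad-≡ₛₛ P Q N a' adm))
         , (λ P Q N a' adm P≢Q P⁺≡Q⁺ → P≢Q (from (sad-≡ₛₛ P Q N a' adm) P⁺≡Q⁺))
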